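{- Let $k\ge 3$ and $n\ge k+1$, and let $G$ be a degree $k$-critical graph on $n$ vertices. Then there exists an ordering $x_1,x_2,\dots,x_n$ of $V(G)$ such that, writing $d^+(x_i)=|\{x_j\in N_G(x_i): j>i\}|$, \[d^+(x_i)=\begin{cases} k & \text{if } i=1,\\ k-1 & \text{if } 2\le i\le n-k+1,\\ n-i & \text{if } n-k+2\le i\le n.\end{cases}\]
   Context: For $k\ge 3$, a graph on $n$ vertices is degree $k$-critical if it has exactly $(k-1)n-\binom{k}{2}+1$ edges and no proper induced subgraph has minimum degree at least $k$. $N_G(v)$ is the neighbourhood of $v$ in $G$. -}

module Defs where

open import Data.Nat using (ℕ; zero; suc; _+_; _*_; _∸_; _≤_; _<ᵇ_)
open import Data.Nat.Combinatorics using (_C_)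
open import Data.Bool using (Bool; true; false; _∧_; if_then_else_)
open import Data.Fin using (Fin; toℕ) renaming (zero to fz; suc to fs)
open import Data.Fin.Subset using (Subset; _∈_; _∉_; ⊤)
open import Data.Fin.Permutation using (Permutation′; _⟨$⟩ʳ_)
open import Data.Product using (_×_; Σ; ∃)
open import Relation.Binary.PropositionalEquality using (_≡_)
open import Relation.Nullary using (¬_)

record Graph (n : ℕ) : Set where
  field
    adj    : Fin n → Fin n → Bool
    sym    : ∀ u v → adj u v ≡ adj v u
    irrefl : ∀ v → adj v v ≡ false
open Graph public

sumF : ∀ {n} → (Fin n → ℕ) → ℕ
sumF {zero}  f = 0
sumF {suc n} f = f fz + sumF (λ i → f (fs i))

count : ∀ {n} → (Fin n → Bool) → ℕ
count p = sumF (λ i → if p i then 1 else 0)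

edges : ∀ {n} → Graph n → ℕ
edges G = sumF (λ u → count (λ v → adj G u v ∧ (toℕ u <ᵇ toℕ v)))

degIn : ∀ {n} → Graph n → Subset n → Fin n → ℕ
degIn G S v = count (λ u → adj G v u ∧ Data.Vec.lookup S u)
  where import Data.Vec

MinDegAtLeast : ∀ {n} → Graph n → Subset n → ℕ → Set
MinDegAtLeast G S k = ∀ v → v ∈ S → k ≤ degIn G S v

ProperNonempty : ∀ {n} → Subset n → Set
ProperNonempty S = (∃ λ v → v ∈ S) × (∃ λ v → v ∉ S)

-- degree k-critical: exactly (k-1)n - C(k,2) + 1 edges (written without
-- truncated subtraction) and no proper (nonempty) induced subgraph has
-- minimum degree at least k
DegreeCritical : ∀ {n} → ℕ → Graph n → Set
DegreeCritical {n} k G =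
  (edges G + k C 2 ≡ (k ∸ 1) * n + 1)
  × (∀ S → ProperNonempty S → ¬ MinDegAtLeast G S k)

-- forward degree of the vertex at position i in the ordering σ
-- (σ maps positions 0..n-1 to vertices)
dPlus : ∀ {n} → Graph n → Permutation′ n → Fin n → ℕ
dPlus G σ i = count (λ j → adj G (σ ⟨$⟩ʳ i) (σ ⟨$⟩ʳ j) ∧ (toℕ i <ᵇ toℕ j))

{-# OPTIONS --safe #-}
module Submission where

-- No proper induced subgraph has minimum degree ≥ k, so the vertices can be peeled off one at a
-- time: first a vertex x₁ with fewer than k neighbours in G minus one vertex (so deg x₁ ≤ k), then
-- repeatedly a vertex xᵢ with fewer than k neighbours in G[xᵢ, …, xₙ], a proper subgraph since it
-- misses x₁. Hence d⁺(x₁) ≤ k and d⁺(xᵢ) ≤ min(k − 1, n − i) for i ≥ 2. These bounds add up to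
-- (k − 1)n − C(k,2) + 1 = |E(G)| = Σ d⁺(xᵢ), so every one of them is attained.

open import Data.Bool using (Bool; true; false; _∧_; if_then_else_; T)
open import Data.Bool.Properties using (T-≡; T-∧)
open import Data.Empty using (⊥-elim)
open import Data.Fin using (Fin; toℕ; fromℕ<) renaming (zero to fz; suc to fs)
open import Data.Fin.Permutation using (Permutation′; _⟨$⟩ʳ_; _⟨$⟩ˡ_; inverseˡ; inverseʳ; transpose; _∘ₚ_)
import Data.Fin.Permutation.Components as PC
open import Data.Fin.Properties using (toℕ-injective; toℕ-fromℕ<; toℕ<n; ¬∀⟶∃¬) renaming (_≟_ to _≟ᶠ_)
open import Data.Fin.Subset using (Subset; _∈_; ⊤; outside)
open import Data.Fin.Subset.Properties using (_∈?_; ∈⊤)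
open import Data.Nat
open import Data.Nat.Combinatorics using (_C_; nC1≡n; nCk+nC[k+1]≡[n+1]C[k+1])
open import Data.Nat.Properties
open import Algebra.Properties.CommutativeMonoid.Sum +-0-commutativeMonoid using (sum; ∑-distrib-+; ∑-comm; ∑-permute)
open import Data.Nat.Tactic.RingSolver using (solve-∀)
open import Data.Product using (_×_; ∃; _,_; proj₂)
open import Data.Sum using (_⊎_; inj₁; inj₂)
open import Data.Vec using (_∷_; lookup; tabulate; there)
open import Data.Vec.Properties using (lookup∘tabulate; []=⇒lookup; lookup⇒[]=; tabulate-cong)
open import Defs hiding (sym)
open import Function using (_∘_)
open import Function.Bundles using (Equivalence)
open import Relation.Binary.PropositionalEquality
open import Relation.Nullary using (¬_; yes; no; contradiction)
open import Relation.Nullary.Decidable using (_→-dec_)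

indicator : Bool → ℕ
indicator b = if b then 1 else 0

sumF≡sum : ∀ {n} (f : Fin n → ℕ) → sumF f ≡ sum f
sumF≡sum {zero}  f = refl
sumF≡sum {suc n} f = cong (f fz +_) (sumF≡sum (f ∘ fs))

sumF-cong : ∀ {n} {f g : Fin n → ℕ} → (∀ i → f i ≡ g i) → sumF f ≡ sumF g
sumF-cong {zero}  f≗g = refl
sumF-cong {suc n} f≗g = cong₂ _+_ (f≗g fz) (sumF-cong (f≗g ∘ fs))

sumF-mono : ∀ {n} {f g : Fin n → ℕ} → (∀ i → f i ≤ g i) → sumF f ≤ sumF g
sumF-mono {zero}  f≤g = z≤n
sumF-mono {suc n} f≤g = +-mono-≤ (f≤g fz) (sumF-mono (f≤g ∘ fs))

sumF-distrib-+ : ∀ {n} (f g : Fin n → ℕ) → sumF (λ i → f i + g i) ≡ sumF f + sumF g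
sumF-distrib-+ f g = begin
  sumF (λ i → f i + g i)  ≡⟨ sumF≡sum (λ i → f i + g i) ⟩
  sum (λ i → f i + g i)   ≡⟨ ∑-distrib-+ f g ⟩
  sum f + sum g           ≡⟨ cong₂ _+_ (sumF≡sum f) (sumF≡sum g) ⟨
  sumF f + sumF g         ∎
  where open ≡-Reasoning

sumF-comm : ∀ {m n} (f : Fin m → Fin n → ℕ) →
            sumF (λ i → sumF (f i)) ≡ sumF (λ j → sumF (λ i → f i j))
sumF-comm f = begin
  sumF (λ i → sumF (f i))                ≡⟨ sumF-cong (λ i → sumF≡sum (f i)) ⟩
  sumF (λ i → sum (f i))                 ≡⟨ sumF≡sum (λ i → sum (f i)) ⟩
  sum (λ i → sum (f i))                  ≡⟨ ∑-comm f ⟩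
  sum (λ j → sum (λ i → f i j))          ≡⟨ sumF≡sum (λ j → sum (λ i → f i j)) ⟨
  sumF (λ j → sum (λ i → f i j))         ≡⟨ sumF-cong (λ j → sumF≡sum (λ i → f i j)) ⟨
  sumF (λ j → sumF (λ i → f i j))        ∎
  where open ≡-Reasoning

sumF-permute : ∀ {n} (σ : Permutation′ n) (f : Fin n → ℕ) → sumF (f ∘ (σ ⟨$⟩ʳ_)) ≡ sumF f
sumF-permute σ f = begin
  sumF (f ∘ (σ ⟨$⟩ʳ_))  ≡⟨ sumF≡sum (f ∘ (σ ⟨$⟩ʳ_)) ⟩
  sum (f ∘ (σ ⟨$⟩ʳ_))   ≡⟨ ∑-permute f σ ⟨
  sum f                 ≡⟨ sumF≡sum f ⟨
  sumF f                ∎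
  where open ≡-Reasoning

sumF-tight : ∀ {n} {f g : Fin n → ℕ} → (∀ i → f i ≤ g i) → sumF g ≤ sumF f → ∀ i → f i ≡ g i
sumF-tight {suc n} {f} {g} f≤g Σg≤Σf fz = ≤-antisym (f≤g fz)
  (+-cancelʳ-≤ (sumF (g ∘ fs)) (g fz) (f fz)
    (≤-trans Σg≤Σf (+-monoʳ-≤ (f fz) (sumF-mono (f≤g ∘ fs)))))
sumF-tight {suc n} {f} {g} f≤g Σg≤Σf (fs i) = sumF-tight (f≤g ∘ fs)
  (+-cancelˡ-≤ (g fz) _ _ (≤-trans Σg≤Σf (+-monoˡ-≤ _ (f≤g fz)))) i

count-mono : ∀ {n} {p q : Fin n → Bool} → (∀ i → T (p i) → T (q i)) → count p ≤ count q
count-mono {p = p} {q} p⇒q = sumF-mono pointwise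
  where
  pointwise : ∀ i → indicator (p i) ≤ indicator (q i)
  pointwise i with p i | q i | p⇒q i
  ... | false | _     | _   = z≤n
  ... | true  | true  | _   = ≤-refl
  ... | true  | false | p⇒f = ⊥-elim (p⇒f _)

count-∧-≤ʳ : ∀ {n} (p q : Fin n → Bool) → count (λ i → p i ∧ q i) ≤ count q
count-∧-≤ʳ p q = count-mono (λ i → proj₂ ∘ Equivalence.to (T-∧ {p i} {q i}))

count-true : ∀ n → count {n} (λ _ → true) ≡ n
count-true zero    = refl
count-true (suc n) = cong suc (count-true n)

count-later : ∀ n m → count {n} (λ j → m <ᵇ toℕ j) ≡ n ∸ suc m
count-later zero    m       = refl
count-later (suc n) zero    = count-true n
count-later (suc n) (suc m) = count-later n m

<ᵇ-exclusive : ∀ m n → m ≢ n → indicator (m <ᵇ n) + indicator (n <ᵇ m) ≡ 1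
<ᵇ-exclusive zero    zero    m≢n = contradiction refl m≢n
<ᵇ-exclusive zero    (suc n) m≢n = refl
<ᵇ-exclusive (suc m) zero    m≢n = refl
<ᵇ-exclusive (suc m) (suc n) m≢n = <ᵇ-exclusive m n (m≢n ∘ cong suc)

indicator-split : ∀ a m n → (m ≡ n → a ≡ false) →
                  indicator a ≡ indicator (a ∧ (m <ᵇ n)) + indicator (a ∧ (n <ᵇ m))
indicator-split false m n _   = refl
indicator-split true  m n m≡n⇒f = sym (<ᵇ-exclusive m n (λ m≡n → contradiction (m≡n⇒f m≡n) λ ()))

relabel : ∀ {n} → Permutation′ n → Graph n → Graph n
relabel σ G = record
  { adj    = λ i j → adj G (σ ⟨$⟩ʳ i) (σ ⟨$⟩ʳ j)
  ; sym    = λ i j → Graph.sym G (σ ⟨$⟩ʳ i) (σ ⟨$⟩ʳ j)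
  ; irrefl = λ i → irrefl G (σ ⟨$⟩ʳ i)
  }

degree : ∀ {n} → Graph n → Fin n → ℕ
degree G v = count (adj G v)

handshake : ∀ {n} (G : Graph n) → 2 * edges G ≡ sumF (degree G)
handshake {n} G = begin
  2 * edges G                                            ≡⟨ cong (edges G +_) (+-identityʳ (edges G)) ⟩
  edges G + sumF (λ u → sumF (up u))                     ≡⟨ cong (edges G +_) (sumF-comm up) ⟩
  edges G + sumF (λ v → sumF (λ u → up u v))             ≡⟨ cong (edges G +_) (sumF-cong (λ v → sumF-cong (up≡down v))) ⟩
  sumF (λ u → sumF (up u)) + sumF (λ u → sumF (down u))  ≡⟨ sumF-distrib-+ (λ u → sumF (up u)) (λ u → sumF (down u)) ⟨
  sumF (λ u → sumF (up u) + sumF (down u))               ≡⟨ sumF-cong (λ u → sumF-distrib-+ (up u) (down u)) ⟨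
  sumF (λ u → sumF (λ v → up u v + down u v))            ≡⟨ sumF-cong (λ u → sumF-cong (split u)) ⟨
  sumF (degree G)                                        ∎
  where
  open ≡-Reasoning
  up down : Fin n → Fin n → ℕ
  up   u v = indicator (adj G u v ∧ (toℕ u <ᵇ toℕ v))
  down u v = indicator (adj G u v ∧ (toℕ v <ᵇ toℕ u))
  up≡down : ∀ v u → up u v ≡ down v u
  up≡down v u = cong (λ b → indicator (b ∧ (toℕ u <ᵇ toℕ v))) (Graph.sym G u v)
  split : ∀ u v → indicator (adj G u v) ≡ up u v + down u v
  split u v = indicator-split (adj G u v) (toℕ u) (toℕ v)
    (λ u≡v → subst (λ w → adj G u w ≡ false) (toℕ-injective u≡v) (irrefl G u))

degree-relabel : ∀ {n} (σ : Permutation′ n) (G : Graph n) → sumF (degree (relabel σ G)) ≡ sumF (degree G)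
degree-relabel σ G = begin
  sumF (λ i → count (λ j → adj G (σ ⟨$⟩ʳ i) (σ ⟨$⟩ʳ j)))  ≡⟨ sumF-cong (λ i → sumF-permute σ (indicator ∘ adj G (σ ⟨$⟩ʳ i))) ⟩
  sumF (λ i → degree G (σ ⟨$⟩ʳ i))                       ≡⟨ sumF-permute σ (degree G) ⟩
  sumF (degree G)                                        ∎
  where open ≡-Reasoning

-- Unlike edges, which counts pairs u < v, the degree sum is visibly invariant under relabelling.
edges-relabel : ∀ {n} (σ : Permutation′ n) (G : Graph n) → edges (relabel σ G) ≡ edges G
edges-relabel σ G = *-cancelˡ-≡ (edges (relabel σ G)) (edges G) 2
  (trans (handshake (relabel σ G)) (trans (degree-relabel σ G) (sym (handshake G))))

sumF-dPlus : ∀ {n} (G : Graph n) (σ : Permutation′ n) → sumF (dPlus G σ) ≡ edges G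
sumF-dPlus G σ = edges-relabel σ G

≤ᵇ-true : ∀ {m n} → m ≤ n → (m ≤ᵇ n) ≡ true
≤ᵇ-true = Equivalence.to T-≡ ∘ ≤⇒≤ᵇ

later : ∀ {n} → Permutation′ n → ℕ → Subset n
later σ i = tabulate (λ v → i ≤ᵇ toℕ (σ ⟨$⟩ˡ v))

∈-later⁺ : ∀ {n} (σ : Permutation′ n) {i v} → i ≤ toℕ (σ ⟨$⟩ˡ v) → v ∈ later σ i
∈-later⁺ σ {i} {v} i≤ = lookup⇒[]= v (later σ i)
  (trans (lookup∘tabulate (λ u → i ≤ᵇ toℕ (σ ⟨$⟩ˡ u)) v) (≤ᵇ-true i≤))

∈-later⁻ : ∀ {n} (σ : Permutation′ n) {i v} → v ∈ later σ i → i ≤ toℕ (σ ⟨$⟩ˡ v)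
∈-later⁻ σ {i} {v} v∈ = ≤ᵇ⇒≤ i _ (Equivalence.from T-≡
  (trans (sym (lookup∘tabulate (λ u → i ≤ᵇ toℕ (σ ⟨$⟩ˡ u)) v)) ([]=⇒lookup v∈)))

dPlus≤degIn : ∀ {n} (G : Graph n) (σ : Permutation′ n) (S : Subset n) p →
              (∀ j → toℕ p < toℕ j → σ ⟨$⟩ʳ j ∈ S) → dPlus G σ p ≤ degIn G S (σ ⟨$⟩ʳ p)
dPlus≤degIn G σ S p later∈S = begin
  dPlus G σ p                                                 ≤⟨ count-mono forward⇒in-S ⟩
  count (λ j → adj G (σ ⟨$⟩ʳ p) (σ ⟨$⟩ʳ j) ∧ lookup S (σ ⟨$⟩ʳ j))  ≡⟨ sumF-permute σ (λ u → indicator (adj G (σ ⟨$⟩ʳ p) u ∧ lookup S u)) ⟩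
  degIn G S (σ ⟨$⟩ʳ p)                                        ∎
  where
  open ≤-Reasoning
  forward⇒in-S : ∀ j → T (adj G (σ ⟨$⟩ʳ p) (σ ⟨$⟩ʳ j) ∧ (toℕ p <ᵇ toℕ j)) →
                 T (adj G (σ ⟨$⟩ʳ p) (σ ⟨$⟩ʳ j) ∧ lookup S (σ ⟨$⟩ʳ j))
  forward⇒in-S j t with Equivalence.to T-∧ t
  ... | adjacent , p<j = Equivalence.from T-∧
    (adjacent , Equivalence.from T-≡ ([]=⇒lookup (later∈S j (<ᵇ⇒< (toℕ p) (toℕ j) p<j))))

dPlus≤remaining : ∀ {n} (G : Graph n) (σ : Permutation′ n) p → dPlus G σ p ≤ n ∸ suc (toℕ p)
dPlus≤remaining {n} G σ p = begin
  dPlus G σ p                       ≤⟨ count-∧-≤ʳ (adj G (σ ⟨$⟩ʳ p) ∘ (σ ⟨$⟩ʳ_)) (λ j → toℕ p <ᵇ toℕ j) ⟩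
  count {n} (λ j → toℕ p <ᵇ toℕ j)  ≡⟨ count-later n (toℕ p) ⟩
  n ∸ suc (toℕ p)                   ∎
  where open ≤-Reasoning

dPlus≤degIn-later : ∀ {n} (G : Graph n) (σ : Permutation′ n) p →
                    dPlus G σ p ≤ degIn G (later σ (toℕ p)) (σ ⟨$⟩ʳ p)
dPlus≤degIn-later G σ p = dPlus≤degIn G σ (later σ (toℕ p)) p
  (λ j p<j → ∈-later⁺ σ (subst (λ i → toℕ p ≤ toℕ i) (sym (inverseˡ σ)) (<⇒≤ p<j)))

degIn-⊤≤suc : ∀ {N} (G : Graph (suc N)) v → degIn G ⊤ v ≤ suc (degIn G (outside ∷ ⊤) v)
degIn-⊤≤suc G v with adj G v fz
... | true  = ≤-refl
... | false = n≤1+n _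

transpose-matchˡ : ∀ {n} (i j : Fin n) → PC.transpose i j i ≡ j
transpose-matchˡ i j with i ≟ᶠ i
... | yes _   = refl
... | no  i≢i = contradiction refl i≢i

transpose-cases : ∀ {n} (i j x : Fin n) →
  (x ≡ i × PC.transpose i j x ≡ j) ⊎ (x ≡ j × PC.transpose i j x ≡ i) ⊎ PC.transpose i j x ≡ x
transpose-cases i j x with x ≟ᶠ i
... | yes x≡i = inj₁ (x≡i , refl)
... | no  _ with x ≟ᶠ j
...   | yes x≡j = inj₂ (inj₁ (x≡j , refl))
...   | no  _   = inj₂ (inj₂ refl)

transpose-below : ∀ {n} (i j x : Fin n) → toℕ x < toℕ i → toℕ x < toℕ j → PC.transpose i j x ≡ x
transpose-below i j x x<i x<j with transpose-cases i j x
... | inj₁ (refl , _)        = contradiction x<i (<-irrefl refl)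
... | inj₂ (inj₁ (refl , _)) = contradiction x<j (<-irrefl refl)
... | inj₂ (inj₂ fixed)      = fixed

transpose-above : ∀ {n} (i j x : Fin n) {m} → m ≤ toℕ i → m ≤ toℕ j →
                  (m ≤ᵇ toℕ (PC.transpose i j x)) ≡ (m ≤ᵇ toℕ x)
transpose-above i j x m≤i m≤j with transpose-cases i j x
... | inj₁ (refl , x↦j)        rewrite x↦j  = trans (≤ᵇ-true m≤j) (sym (≤ᵇ-true m≤i))
... | inj₂ (inj₁ (refl , x↦i)) rewrite x↦i  = trans (≤ᵇ-true m≤i) (sym (≤ᵇ-true m≤j))
... | inj₂ (inj₂ x↦x)          rewrite x↦x = refl

lowDegreeVertex : ∀ {n} (G : Graph n) (S : Subset n) k → ¬ MinDegAtLeast G S k →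
                  ∃ λ v → v ∈ S × degIn G S v < k
lowDegreeVertex {n} G S k ¬minDeg
  with ¬∀⟶∃¬ n (λ v → v ∈ S → k ≤ degIn G S v) (λ v → (v ∈? S) →-dec (k ≤? degIn G S v)) ¬minDeg
... | v , ¬high with v ∈? S
...   | yes v∈S = v , v∈S , ≰⇒> (λ high → ¬high (λ _ → high))
...   | no  v∉S = contradiction (λ v∈S → contradiction v∈S v∉S) ¬high

later-proper : ∀ {N} (σ : Permutation′ (suc N)) ι → 1 ≤ toℕ ι → ProperNonempty (later σ (toℕ ι))
later-proper σ ι 1≤ι =
    (σ ⟨$⟩ʳ ι , ∈-later⁺ σ (≤-reflexive (cong toℕ (sym (inverseˡ σ)))))
  , (σ ⟨$⟩ʳ fz , λ first∈ → contradiction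
      (≤-trans 1≤ι (subst (λ x → toℕ ι ≤ toℕ x) (inverseˡ σ) (∈-later⁻ σ first∈))) λ ())

Peeled : ∀ {n} → Graph n → ℕ → Permutation′ n → ℕ → Set
Peeled G k σ i = ∀ p → 1 ≤ toℕ p → toℕ p < i → degIn G (later σ (toℕ p)) (σ ⟨$⟩ʳ p) < k

module Peeling {N} (G : Graph (suc N)) (k : ℕ)
               (critical : ∀ S → ProperNonempty S → ¬ MinDegAtLeast G S k) where

  -- Swapping two positions ≥ ι leaves the earlier positions and the sets later σ m, m ≤ ι, unchanged.
  peel-step : ∀ σ ι → 1 ≤ toℕ ι → Peeled G k σ (toℕ ι) →
              ∃ λ σ' → σ' ⟨$⟩ʳ fz ≡ σ ⟨$⟩ʳ fz × Peeled G k σ' (suc (toℕ ι))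
  peel-step σ ι 1≤ι peeled
    with lowDegreeVertex G (later σ (toℕ ι)) k (critical (later σ (toℕ ι)) (later-proper σ ι 1≤ι))
  ... | v , v∈later , v-low = σ' , unchanged fz 1≤ι , peeled′
    where
    j : Fin (suc N)
    j = σ ⟨$⟩ˡ v
    ι≤j : toℕ ι ≤ toℕ j
    ι≤j = ∈-later⁻ σ v∈later
    σ' : Permutation′ (suc N)
    σ' = transpose ι j ∘ₚ σ
    unchanged : ∀ p → toℕ p < toℕ ι → σ' ⟨$⟩ʳ p ≡ σ ⟨$⟩ʳ p
    unchanged p p<ι = cong (σ ⟨$⟩ʳ_) (transpose-below ι j p p<ι (<-≤-trans p<ι ι≤j))
    later-unchanged : ∀ m → m ≤ toℕ ι → later σ' m ≡ later σ m
    later-unchanged m m≤ι = tabulate-cong (λ u → transpose-above j ι (σ ⟨$⟩ˡ u) (≤-trans m≤ι ι≤j) m≤ι)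
    σ'ι≡v : σ' ⟨$⟩ʳ ι ≡ v
    σ'ι≡v = trans (cong (σ ⟨$⟩ʳ_) (transpose-matchˡ ι j)) (inverseʳ σ)
    peeled′ : Peeled G k σ' (suc (toℕ ι))
    peeled′ p 1≤p p≤ι with m<1+n⇒m<n∨m≡n p≤ι
    ... | inj₁ p<ι = subst₂ (λ S w → degIn G S w < k)
            (sym (later-unchanged (toℕ p) (<⇒≤ p<ι))) (sym (unchanged p p<ι)) (peeled p 1≤p p<ι)
    ... | inj₂ p≡ι with toℕ-injective p≡ι
    ...   | refl = subst₂ (λ S w → degIn G S w < k)
            (sym (later-unchanged (toℕ ι) ≤-refl)) (sym σ'ι≡v) v-low

  peeling : ∀ y i → 1 ≤ i → i ≤ suc N → ∃ λ σ → σ ⟨$⟩ʳ fz ≡ y × Peeled G k σ i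
  peeling y (suc zero) _ _ =
    transpose fz y , transpose-matchˡ fz y , λ p 1≤p p<1 → contradiction (<-≤-trans p<1 1≤p) (<-irrefl refl)
  peeling y (suc (suc i)) _ i<n
    with peeling y (suc i) (s≤s z≤n) (<⇒≤ i<n) | toℕ-fromℕ< i<n
  ... | σ , σ₀≡y , peeled | ι≡i
    with peel-step σ (fromℕ< i<n) (subst (1 ≤_) (sym ι≡i) (s≤s z≤n)) (subst (Peeled G k σ) (sym ι≡i) peeled)
  ... | σ' , σ'₀≡σ₀ , peeled′ = σ' , trans σ'₀≡σ₀ σ₀≡y , subst (Peeled G k σ' ∘ suc) ι≡i peeled′

[1+n]C2≡n+nC2 : ∀ n → suc n C 2 ≡ n + n C 2
[1+n]C2≡n+nC2 n = trans (sym (nCk+nC[k+1]≡[n+1]C[k+1] n 1)) (cong (_+ n C 2) (nC1≡n n))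

nC2+[1+n]C2≡n*n : ∀ n → n C 2 + suc n C 2 ≡ n * n
nC2+[1+n]C2≡n*n zero    = refl
nC2+[1+n]C2≡n*n (suc n) = begin
  suc n C 2 + suc (suc n) C 2                ≡⟨ cong (suc n C 2 +_) ([1+n]C2≡n+nC2 (suc n)) ⟩
  suc n C 2 + (suc n + suc n C 2)            ≡⟨ cong (λ c → c + (suc n + c)) ([1+n]C2≡n+nC2 n) ⟩
  (n + n C 2) + (suc n + (n + n C 2))        ≡⟨ regroup n (n C 2) ⟩
  suc n + n + (n C 2 + (n + n C 2))          ≡⟨ cong (λ c → suc n + n + (n C 2 + c)) ([1+n]C2≡n+nC2 n) ⟨
  suc n + n + (n C 2 + suc n C 2)            ≡⟨ cong (suc n + n +_) (nC2+[1+n]C2≡n*n n) ⟩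
  suc n + n + n * n                          ≡⟨ square n ⟩
  suc n * suc n                              ∎
  where
  open ≡-Reasoning
  regroup : ∀ n c → (n + c) + (suc n + (n + c)) ≡ suc n + n + (c + (n + c))
  regroup = solve-∀
  square : ∀ n → suc n + n + n * n ≡ suc n * suc n
  square = solve-∀

-- For k = suc K and n = suc N: k at position 0, and min(k − 1, n − 1 − p) at position p ≥ 1.
profile : (K N : ℕ) → Fin (suc N) → ℕ
profile K N fz     = suc K
profile K N (fs q) = K ⊓ (N ∸ suc (toℕ q))

∑min : ℕ → ℕ → ℕ
∑min K N = sumF {N} (λ q → K ⊓ (N ∸ suc (toℕ q)))

∑min-short : ∀ K N → N ≤ K → ∑min K N ≡ N C 2
∑min-short K zero    _     = refl
∑min-short K (suc N) 1+N≤K = begin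
  K ⊓ N + ∑min K N  ≡⟨ cong₂ _+_ (m≥n⇒m⊓n≡n N≤K) (∑min-short K N N≤K) ⟩
  N + N C 2         ≡⟨ [1+n]C2≡n+nC2 N ⟨
  suc N C 2         ∎
  where
  open ≡-Reasoning
  N≤K : N ≤ K
  N≤K = ≤-trans (n≤1+n N) 1+N≤K

∑min-long : ∀ K N → K ≤ N → ∑min K N + suc K C 2 ≡ K * N
∑min-long K N K≤N with m≤n⇒m<n∨m≡n K≤N
... | inj₂ refl = trans (cong (_+ suc K C 2) (∑min-short K K ≤-refl)) (nC2+[1+n]C2≡n*n K)
∑min-long K (suc N) _ | inj₁ K<1+N = begin
  K ⊓ N + ∑min K N + suc K C 2    ≡⟨ cong (λ m → m + ∑min K N + suc K C 2) (m≤n⇒m⊓n≡m K≤N) ⟩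
  K + ∑min K N + suc K C 2        ≡⟨ +-assoc K (∑min K N) (suc K C 2) ⟩
  K + (∑min K N + suc K C 2)      ≡⟨ cong (K +_) (∑min-long K N K≤N) ⟩
  K + K * N                       ≡⟨ *-suc K N ⟨
  K * suc N                       ∎
  where
  open ≡-Reasoning
  K≤N : K ≤ N
  K≤N = s≤s⁻¹ K<1+N

∑profile : ∀ K N → K ≤ N → sumF (profile K N) + suc K C 2 ≡ K * suc N + 1
∑profile K N K≤N = begin
  suc K + ∑min K N + suc K C 2    ≡⟨ +-assoc (suc K) (∑min K N) (suc K C 2) ⟩
  suc K + (∑min K N + suc K C 2)  ≡⟨ cong (suc K +_) (∑min-long K N K≤N) ⟩
  suc K + K * N                   ≡⟨ rearrange K N ⟩
  K * suc N + 1                   ∎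
  where
  open ≡-Reasoning
  rearrange : ∀ K N → suc K + K * N ≡ K * suc N + 1
  rearrange = solve-∀

critical-profile : ∀ K N → suc K ≤ N → (G : Graph (suc N)) → DegreeCritical (suc K) G →
                   ∃ λ σ → ∀ p → dPlus G σ p ≡ profile K N p
critical-profile K N@(suc _) K<N G (edgeCount , critical)
  with lowDegreeVertex G (outside ∷ ⊤) (suc K) (critical (outside ∷ ⊤) ((fs fz , there ∈⊤) , (fz , λ ())))
... | y , _ , y-low with Peeling.peeling G (suc K) critical y (suc N) (s≤s z≤n) ≤-refl
... | σ , σ₀≡y , peeled = σ , sumF-tight dPlus≤profile ∑profile≤∑dPlus
  where
  dPlus≤profile : ∀ p → dPlus G σ p ≤ profile K N p
  dPlus≤profile fz = begin
    dPlus G σ fz                          ≤⟨ dPlus≤degIn G σ ⊤ fz (λ _ _ → ∈⊤) ⟩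
    degIn G ⊤ (σ ⟨$⟩ʳ fz)                 ≤⟨ degIn-⊤≤suc G (σ ⟨$⟩ʳ fz) ⟩
    suc (degIn G (outside ∷ ⊤) (σ ⟨$⟩ʳ fz)) ≡⟨ cong (suc ∘ degIn G (outside ∷ ⊤)) σ₀≡y ⟩
    suc (degIn G (outside ∷ ⊤) y)          ≤⟨ y-low ⟩
    suc K                                 ∎
    where open ≤-Reasoning
  dPlus≤profile (fs q) = ⊓-glb
    (s≤s⁻¹ (<-≤-trans (s≤s (dPlus≤degIn-later G σ (fs q))) (peeled (fs q) (s≤s z≤n) (toℕ<n (fs q)))))
    (dPlus≤remaining G σ (fs q))
  ∑profile≤∑dPlus : sumF (profile K N) ≤ sumF (dPlus G σ)
  ∑profile≤∑dPlus = ≤-reflexive (begin-equality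
    sumF (profile K N)   ≡⟨ +-cancelʳ-≡ (suc K C 2) _ _ (trans (∑profile K N (<⇒≤ K<N)) (sym edgeCount)) ⟩
    edges G              ≡⟨ sumF-dPlus G σ ⟨
    sumF (dPlus G σ)     ∎)
    where open ≤-Reasoning

profile-middle : ∀ K N → K ≤ N → ∀ p → 2 ≤ suc (toℕ p) → suc (toℕ p) ≤ N ∸ K + 1 → profile K N p ≡ K
profile-middle K N K≤N fz     (s≤s ()) _
profile-middle K N K≤N (fs q) _        p≤ = m≤n⇒m⊓n≡m (begin
  K                    ≡⟨ m∸[m∸n]≡n K≤N ⟨
  N ∸ (N ∸ K)          ≤⟨ ∸-monoʳ-≤ N (s≤s⁻¹ (subst (suc (suc (toℕ q)) ≤_) (+-comm (N ∸ K) 1) p≤)) ⟩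
  N ∸ suc (toℕ q)      ∎)
  where open ≤-Reasoning

profile-last : ∀ K N → K ≤ N → ∀ p → N ∸ K + 2 ≤ suc (toℕ p) → profile K N p ≡ N ∸ toℕ p
profile-last K N K≤N fz     ≤p = contradiction (m+n≤o⇒n≤o (N ∸ K) ≤p) λ { (s≤s ()) }
profile-last K N K≤N (fs q) ≤p = m≥n⇒m⊓n≡n (begin
  N ∸ suc (toℕ q)      ≤⟨ ∸-monoʳ-≤ N (m≤n⇒m≤1+n (m+n≤o⇒m≤o∸n (N ∸ K) ≤p)) ⟩
  N ∸ (N ∸ K)          ≡⟨ m∸[m∸n]≡n K≤N ⟩
  K                    ∎)
  where open ≤-Reasoning

lemma4p1 : (k n : ℕ) → 3 ≤ k → k + 1 ≤ n → (G : Graph n) → DegreeCritical k G →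
    ∃ λ (σ : Permutation′ n) →
      (∀ p → suc (toℕ p) ≡ 1 → dPlus G σ p ≡ k)
      × (∀ p → 2 ≤ suc (toℕ p) → suc (toℕ p) ≤ n ∸ k + 1 → dPlus G σ p ≡ k ∸ 1)
      × (∀ p → n ∸ k + 2 ≤ suc (toℕ p) → suc (toℕ p) ≤ n → dPlus G σ p ≡ n ∸ suc (toℕ p))
-- The hypothesis 3 ≤ k is only used to exclude k = 0.
lemma4p1 zero    _       ()  _     _ _
lemma4p1 (suc K) zero    _   ()    _ _
lemma4p1 (suc K) (suc N) _   k+1≤n G critical
  with critical-profile K N (m+n≤o⇒m≤o∸n (suc K) k+1≤n) G critical
... | σ , dPlus≡profile =
    σ
  , (λ { fz _ → dPlus≡profile fz ; (fs _) () })
  , (λ p 2≤p p≤ → trans (dPlus≡profile p) (profile-middle K N K≤N p 2≤p p≤))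
  , (λ p ≤p _ → trans (dPlus≡profile p) (profile-last K N K≤N p ≤p))
  where
  K≤N : K ≤ N
  K≤N = <⇒≤ (m+n≤o⇒m≤o∸n (suc K) k+1≤n)
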